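{- Let $(\mathcal{R},\leq,r)$ be a weak \textbf{A2} space (resp. an \textbf{A2}-space). Then the closed triple $(\mathcal{R} \times 2^\omega,\preceq,r)$ defined in the context below is a weak \textbf{A2} space (resp. an \textbf{A2}-space) which has a biasymptotic set.
   Context: A triple $(\mathcal{R},\leq,r)$ consists of a non-empty set $\mathcal{R}$, a quasi-order $\leq$ on $\mathcal{R}$, and a function $r:\mathcal{R}\times\omega\to\mathcal{AR}$; write $r_n(A):=r(A,n)$ and $\mathcal{AR}_n$ for the image of $r_n$. It is a weak \textbf{A2} space if it is a closed triple (i.e. $\mathcal{R}$, identified via $A\mapsto(r_n(A))_n$ with a subset of $\mathcal{AR}^{\mathbb{N}}$, is metrically closed) satisfying Todorčević's axioms \textbf{A1} and \textbf{A3} together with axiom weak \textbf{A2}: there is a quasi-order $\leq_\mathrm{fin}$ on $\mathcal{AR}$ such that $\{a : a\leq_\mathrm{fin} b\}$ is countable for every $b$, $A\leq B$ iff $\forall n\,\exists m\,[r_n(A)\leq_\mathrm{fin} r_m(B)]$, and if $a\sqsubseteq b$ and $b\leq_\mathrm{fin} c$ then $a\leq_\mathrm{fin} d$ for some $d\sqsubseteq c$. It is an \textbf{A2}-space if moreover $\{a : a\leq_\mathrm{fin} b\}$ is finite for every $b$. For $A\in\mathcal{R}$ and $a\in\mathcal{AR}$ with $a \leq_\mathrm{fin} r_n(A)$ for some $n$, $[a,A]:=\{B\leq A : \exists n\, r_n(B)=a\}$, $[n,A]:=[r_n(A),A]$, $\mathrm{depth}_A(a)$ is the least $n$ with $a\leq_\mathrm{fin}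 r_n(A)$, $\mathrm{lh}(a)$ is the unique $n$ with $a\in\mathcal{AR}_n$, and $r_n[a,A]$ is the set of $b$ of length $n$ with $a\sqsubseteq b$ and $b\leq_\mathrm{fin} r_m(A)$ for some $m$. A set $\mathcal{O}\subseteq\mathcal{AR}$ is biasymptotic if for all such $A,a$ and all $B\in[\mathrm{depth}_A(a),A]$, $r_{\mathrm{lh}(a)+1}[a,B]\cap\mathcal{O}\neq\emptyset$ and $r_{\mathrm{lh}(a)+1}[a,B]\setminus\mathcal{O}\neq\emptyset$. Given $(\mathcal{R},\leq,r)$, the triple $(\mathcal{R}\times 2^\omega,\preceq,r)$ is defined by: $\mathcal{A}(\mathcal{R}\times 2^\omega):=\bigcup_{n<\omega}\mathcal{AR}_n\times 2^n$; $r_n(A,u):=(r_n(A),u\restriction n)$ for $(A,u)\in\mathcal{R}\times 2^\omega$; $(a,p)\preceq_\mathrm{fin}(b,q)$ iff $a\leq_\mathrm{fin} b$; and $(A,u)\preceq(B,v)$ iff $\forall n\,\exists m\,[r_n(A,u)\preceq_\mathrm{fin} r_m(B,v)]$. -}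

module Defs where

open import Data.Nat using (ℕ; zero; suc; _<_) renaming (_≤_ to _≤ℕ_)
open import Data.Bool using (Bool)
open import Data.List using (List; applyUpTo)
open import Data.List.Membership.Propositional using (_∈_)
open import Data.Maybe using (Maybe; just)
open import Data.Product using (Σ; ∃; ∃-syntax; Σ-syntax; _×_; _,_)
open import Relation.Nullary using (¬_)
open import Relation.Binary.PropositionalEquality using (_≡_)
open import Relation.Binary.Structures using (IsEquivalence)

-- Since 2^ω-valued components
-- cannot be compared with ≡ without function extensionality, R carries
-- its own equality _≈_ (in the paper: plain equality of elements of R).

record Triple : Set₁ where
  field
    R   : Set
    _≈_ : R → R → Set
    AR  : Set
    _≤_ : R → R → Set
    r   : ℕ → R → AR

FinRel : Triple → Set₁
FinRel T = Triple.AR T → Triple.AR T → Set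

SizeNotion : Set₁
SizeNotion = ∀ {X : Set} → (X → Set) → Set

-- S is countable: S is contained in the range of a sequence (Maybe allows S = ∅).
Countable : SizeNotion
Countable {X} S = Σ[ f ∈ (ℕ → Maybe X) ] ((x : X) → S x → ∃[ n ] (f n ≡ just x))

Finite : SizeNotion
Finite {X} S = Σ[ L ∈ List X ] ((x : X) → S x → x ∈ L)

module _ (T : Triple) where
  open Triple T

  InAR : ℕ → AR → Set
  InAR n a = ∃[ A ] (r n A ≡ a)

  IsApprox : AR → Set
  IsApprox a = ∃[ n ] InAR n a

  _⊑_ : AR → AR → Set
  a ⊑ b = ∃[ A ] ∃[ n ] ∃[ m ] (n ≤ℕ m × r n A ≡ a × r m A ≡ b)

  InBracket : AR → R → R → Set
  InBracket a A B = (B ≤ A) × ∃[ n ] (r n B ≡ a)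

  InNBracket : ℕ → R → R → Set
  InNBracket n A B = InBracket (r n A) A B

  Closed : Set
  Closed = (x : ℕ → AR) →
           ((n : ℕ) → ∃[ A ] ((k : ℕ) → k < n → r k A ≡ x k)) →
           ∃[ A ] ((k : ℕ) → r k A ≡ x k)

  QuasiOrderR : Set
  QuasiOrderR = ((A : R) → A ≤ A) × ((A B C : R) → A ≤ B → B ≤ C → A ≤ C)

  A1 : Set
  A1 = ((A B : R) → r 0 A ≡ r 0 B)
     × ((A B : R) → ((n : ℕ) → r n A ≡ r n B) → A ≈ B)
     × ((A B : R) (n m : ℕ) → r n A ≡ r m B →
          (n ≡ m) × ((k : ℕ) → k < n → r k A ≡ r k B))

  module _ (_≤fin_ : FinRel T) where

    IsDepth : R → AR → ℕ → Set
    IsDepth A a n = (a ≤fin r n A) × ((m : ℕ) → m < n → ¬ (a ≤fin r m A))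

    InRN : ℕ → AR → R → AR → Set
    InRN n a A b = InAR n b × a ⊑ b × ∃[ m ] (b ≤fin r m A)

    A2With : SizeNotion → Set
    A2With Small =
        ((a : AR) → IsApprox a → a ≤fin a)
      × ((a b c : AR) → IsApprox a → IsApprox b → IsApprox c →
           a ≤fin b → b ≤fin c → a ≤fin c)
      × ((b : AR) → IsApprox b → Small (λ a → IsApprox a × a ≤fin b))
      × ((A B : R) → (A ≤ B → (n : ℕ) → ∃[ m ] (r n A ≤fin r m B))
                   × (((n : ℕ) → ∃[ m ] (r n A ≤fin r m B)) → A ≤ B))
      × ((a b c : AR) → IsApprox c → a ⊑ b → b ≤fin c →
           ∃[ d ] (d ⊑ c × a ≤fin d))

    A3 : Set
    A3 = ((a : AR) (B : R) (n : ℕ) → IsApprox a → IsDepth B a n →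
            (A : R) → InNBracket n B A → ∃[ C ] InBracket a A C)
       × ((a : AR) (A B : R) (n : ℕ) → A ≤ B → ∃[ C ] InBracket a A C →
            IsDepth B a n →
            ∃[ A' ] (InNBracket n B A'
                     × ∃[ C ] InBracket a A' C
                     × ((C : R) → InBracket a A' C → InBracket a A C)))

    -- Small = Countable: weak A2 space; Small = Finite: A2-space.
    IsSpaceWith : SizeNotion → Set
    IsSpaceWith Small = Closed × IsEquivalence _≈_ × QuasiOrderR
                      × A1 × A2With Small × A3

    Biasymptotic : (AR → Set) → Set
    Biasymptotic O =
      (A : R) (a : AR) (d l : ℕ) → InAR l a → IsDepth A a d →
      (B : R) → InNBracket d A B →
      (∃[ b ] (InRN (suc l) a B b × O b)) × (∃[ b ] (InRN (suc l) a B b × ¬ O b))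

restrict : (ℕ → Bool) → ℕ → List Bool
restrict u n = applyUpTo u n

module _ (T : Triple) (_≤fin_ : FinRel T) where
  open Triple T

  prodAR : Set
  prodAR = AR × List Bool

  prodR : Set
  prodR = R × (ℕ → Bool)

  prodr : ℕ → prodR → prodAR
  prodr n (A , u) = (r n A , restrict u n)

  _⪯fin_ : prodAR → prodAR → Set
  (a , p) ⪯fin (b , q) = a ≤fin b

  _⪯_ : prodR → prodR → Set
  X ⪯ Y = (n : ℕ) → ∃[ m ] (prodr n X ⪯fin prodr m Y)

  _≈×_ : prodR → prodR → Set
  (A , u) ≈× (B , v) = (A ≈ B) × ((n : ℕ) → u n ≡ v n)

  ProdTriple : Triple
  ProdTriple = record
    { R = prodR ; _≈_ = _≈×_ ; AR = prodAR ; _≤_ = _⪯_ ; r = prodr }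

{-# OPTIONS --safe #-}
-- The order ⪯fin ignores bit strings, and by A1 an approximation a determines its
-- level l, so (a , p) is an approximation exactly when p has l bits; hence every
-- witness D for a can be paired with any bit sequence extending p.  This transfers
-- closedness and A1–A3 from R to R × 2^ω.  The approximations ⪯fin (b , q) are the
-- a ≤fin b paired with bit strings: countably many, or the 2^l strings of the level
-- l of each a (a level known only classically, hence excluded middle).
-- The approximations whose bit string ends in 1 form a biasymptotic set: given
-- (a , p) of level l and B in [depth a, A], A3 yields C ≤ B through a, and C paired
-- with p extended by 1 or by 0 gives members of r_(l+1)[(a , p), B] on both sides.
module Submission where

open import Defs
open import Data.Product using (_×_; ∃-syntax)
open import Axiom.ExcludedMiddle using (ExcludedMiddle)
open import Level using (0ℓ)

open import Data.Bool using (Bool; true; false; if_then_else_)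
open import Data.List using (List; []; _∷_; _∷ʳ_; [_]; _++_; applyUpTo; last; map; concatMap; cartesianProductWith; replicate)
open import Data.List.Properties using (applyUpTo-∷ʳ; ∷ʳ-injective)
open import Data.List.Membership.Propositional using (_∈_)
open import Data.List.Membership.Propositional.Properties using (∈-map⁺; ∈-concatMap⁺; ∈-cartesianProductWith⁺)
open import Data.List.Relation.Unary.Any as Any using (here; there)
open import Data.Maybe as Maybe using (Maybe; just; fromMaybe)
open import Data.Nat using (ℕ; zero; suc; _<_; _<?_; _≤′_; ≤′-refl; ≤′-step; z<s; s<s) renaming (_≤_ to _≤ℕ_)
open import Data.Nat.Properties using (≤-refl; n≤1+n; n≮n; <⇒≤; ≤⇒≤′)
open import Data.Nat.Binary using (ℕᵇ; zero; 2[1+_]; 1+[2_]; fromℕ; toℕ)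
open import Data.Nat.Binary.Properties using (fromℕ-toℕ)
open import Data.Product using (_,_; proj₁; proj₂; map₁)
open import Data.Product.Relation.Binary.Pointwise.NonDependent using (×-isEquivalence)
open import Function using (_∘_; id; case_of_)
open import Function.Definitions using (StrictlySurjective)
open import Relation.Binary using (Setoid)
open import Relation.Binary.PropositionalEquality using (_≡_; _→-setoid_; refl; sym; trans; cong; cong₂; subst; module ≡-Reasoning)
open import Relation.Binary.Structures using (IsEquivalence)
open import Relation.Nullary using (Dec; yes; no; does; contradiction)
open import Relation.Nullary.Decidable using (dec-true; dec-false)
open import Relation.Unary using (Pred; _⊆_)

open ≡-Reasoning

module _ {A : Set} where

  applyUpTo-cong : ∀ {f g : ℕ → A} n → (∀ i → i < n → f i ≡ g i) →
                   applyUpTo f n ≡ applyUpTo g n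
  applyUpTo-cong zero    _   = refl
  applyUpTo-cong {f} {g} (suc n) f≗g = cong₂ _∷_ (f≗g 0 z<s)
    (applyUpTo-cong {f ∘ suc} {g ∘ suc} n (λ i i<n → f≗g (suc i) (s<s i<n)))

  applyUpTo-suc-injective : ∀ {f g : ℕ → A} {n} →
    applyUpTo f (suc n) ≡ applyUpTo g (suc n) →
    applyUpTo f n ≡ applyUpTo g n × f n ≡ g n
  applyUpTo-suc-injective {f} {g} {n} e = ∷ʳ-injective _ _ (begin
    applyUpTo f n ∷ʳ f n  ≡⟨ applyUpTo-∷ʳ f n ⟩
    applyUpTo f (suc n)   ≡⟨ e ⟩
    applyUpTo g (suc n)   ≡⟨ applyUpTo-∷ʳ g n ⟨
    applyUpTo g n ∷ʳ g n  ∎)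

  applyUpTo-prefix : ∀ {f g : ℕ → A} {k n} → k ≤ℕ n →
    applyUpTo f n ≡ applyUpTo g n → applyUpTo f k ≡ applyUpTo g k
  applyUpTo-prefix {f} {g} {k} k≤n = prefix (≤⇒≤′ k≤n)
    where
    prefix : ∀ {n} → k ≤′ n → applyUpTo f n ≡ applyUpTo g n → applyUpTo f k ≡ applyUpTo g k
    prefix ≤′-refl         e = e
    prefix (≤′-step k≤′n) e = prefix k≤′n (proj₁ (applyUpTo-suc-injective e))

  applyUpTo-agree : ∀ {f g : ℕ → A} {i n} → i < n →
    applyUpTo f n ≡ applyUpTo g n → f i ≡ g i
  applyUpTo-agree {f} {g} i<n e =
    proj₂ (applyUpTo-suc-injective {f} {g} (applyUpTo-prefix i<n e))

  last-applyUpTo : ∀ (f : ℕ → A) n → last (applyUpTo f (suc n)) ≡ just (f n)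
  last-applyUpTo f zero    = refl
  last-applyUpTo f (suc n) = last-applyUpTo (f ∘ suc) n

  prefixThen : (ℕ → A) → ℕ → A → ℕ → A
  prefixThen f n x i = if does (i <? n) then f i else x

  prefixThen-< : ∀ (f : ℕ → A) {n} x {i} → i < n → prefixThen f n x i ≡ f i
  prefixThen-< f {n} x {i} i<n = cong (if_then f i else x) (dec-true (i <? n) i<n)

  prefixThen-self : ∀ (f : ℕ → A) n x → prefixThen f n x n ≡ x
  prefixThen-self f n x = cong (if_then f n else x) (dec-false (n <? n) (n≮n n))

-- ℕᵇ's constructors are the two ways of consing a bit, so ℕ ≅ ℕᵇ ≅ List Bool;
-- a unary prefix then splits a natural number off a bit string.

toBits : ℕᵇ → List Bool
toBits zero      = []
toBits 2[1+ x ]  = true ∷ toBits x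
toBits 1+[2 x ]  = false ∷ toBits x

fromBits : List Bool → ℕᵇ
fromBits []          = zero
fromBits (true ∷ p)  = 2[1+ fromBits p ]
fromBits (false ∷ p) = 1+[2 fromBits p ]

toBits-fromBits : ∀ p → toBits (fromBits p) ≡ p
toBits-fromBits []          = refl
toBits-fromBits (true ∷ p)  = cong (true ∷_) (toBits-fromBits p)
toBits-fromBits (false ∷ p) = cong (false ∷_) (toBits-fromBits p)

unpair : List Bool → ℕ × List Bool
unpair []          = 0 , []
unpair (false ∷ p) = 0 , p
unpair (true ∷ p)  = map₁ suc (unpair p)

pair : ℕ → List Bool → List Bool
pair i p = replicate i true ++ false ∷ p

unpair-pair : ∀ i p → unpair (pair i p) ≡ (i , p)
unpair-pair zero    p = refl
unpair-pair (suc i) p = cong (map₁ suc) (unpair-pair i p)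

decode : ℕ → ℕ × List Bool
decode = unpair ∘ toBits ∘ fromℕ

decode-surjective : StrictlySurjective _≡_ decode
decode-surjective (i , p) = toℕ (fromBits (pair i p)) , (begin
  unpair (toBits (fromℕ (toℕ (fromBits (pair i p)))))
    ≡⟨ cong (unpair ∘ toBits) (fromℕ-toℕ (fromBits (pair i p))) ⟩
  unpair (toBits (fromBits (pair i p)))  ≡⟨ cong unpair (toBits-fromBits (pair i p)) ⟩
  unpair (pair i p)                      ≡⟨ unpair-pair i p ⟩
  (i , p)                                ∎)

bitstrings : ℕ → List (List Bool)
bitstrings zero    = [ [] ]
bitstrings (suc n) = cartesianProductWith _∷_ (false ∷ true ∷ []) (bitstrings n)

restrict-∈-bitstrings : ∀ u n → restrict u n ∈ bitstrings n
restrict-∈-bitstrings u zero    = here refl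
restrict-∈-bitstrings u (suc n) =
  ∈-cartesianProductWith⁺ _∷_ (bit∈ (u 0)) (restrict-∈-bitstrings (u ∘ suc) n)
  where
  bit∈ : ∀ b → b ∈ false ∷ true ∷ []
  bit∈ false = here refl
  bit∈ true  = there (here refl)

module _ {X : Set} where

  Countable-⊆ : {S S′ : Pred X 0ℓ} → S′ ⊆ S → Countable S → Countable S′
  Countable-⊆ S′⊆S (f , covers) = f , λ x → covers x ∘ S′⊆S

  Finite-⊆ : {S S′ : Pred X 0ℓ} → S′ ⊆ S → Finite S → Finite S′
  Finite-⊆ S′⊆S (xs , complete) = xs , λ x → complete x ∘ S′⊆S

  Countable-×ʳ : {Y : Set} {S : Pred X 0ℓ} (e : ℕ → ℕ × Y) → StrictlySurjective _≡_ e →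
                 Countable S → Countable {X × Y} (S ∘ proj₁)
  Countable-×ʳ {Y} {S} e e-surjective (f , covers) = tag ∘ e , covers×
    where
    tag : ℕ × Y → Maybe (X × Y)
    tag (i , y) = Maybe.map (_, y) (f i)
    covers× : (xy : X × Y) → S (proj₁ xy) → ∃[ n ] (tag (e n) ≡ just xy)
    covers× (x , y) sx with i , fi≡x ← covers x sx with n , en≡iy ← e-surjective (i , y) =
      n , (begin
        tag (e n)               ≡⟨ cong tag en≡iy ⟩
        Maybe.map (_, y) (f i)  ≡⟨ cong (Maybe.map (_, y)) fi≡x ⟩
        just (x , y)            ∎)

  -- The list for S may contain elements outside S, which have no fibre at hand;
  -- excluded middle filters them out.
  Finite-Σ : ExcludedMiddle 0ℓ → {Y : Set} {S : Pred X 0ℓ} {F : X → Pred Y 0ℓ} →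
             Finite S → (∀ x → S x → Finite (F x)) →
             Finite {X × Y} (λ (x , y) → S x × F x y)
  Finite-Σ em {Y} {S} {F} (xs , complete) fibres = concatMap fibre xs , complete×
    where
    fibreIf : (x : X) → Dec (S x) → List (X × Y)
    fibreIf x (yes sx) = map (x ,_) (proj₁ (fibres x sx))
    fibreIf x (no _)   = []
    fibre : X → List (X × Y)
    fibre x = fibreIf x em
    ∈-fibreIf : ∀ {x y} → S x → F x y → (d : Dec (S x)) → (x , y) ∈ fibreIf x d
    ∈-fibreIf {x} {y} _  fxy (yes sx) = ∈-map⁺ (x ,_) (proj₂ (fibres x sx) y fxy)
    ∈-fibreIf         sx _   (no ¬sx) = contradiction sx ¬sx
    complete× : (xy : X × Y) → S (proj₁ xy) × F (proj₁ xy) (proj₂ xy) → xy ∈ concatMap fibre xs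
    complete× (x , y) (sx , fxy) =
      ∈-concatMap⁺ fibre (Any.map (λ { refl → ∈-fibreIf sx fxy em }) (complete x sx))

Below : (T : Triple) → FinRel T → Triple.AR T → Pred (Triple.AR T) 0ℓ
Below T _≤fin_ b a = IsApprox T a × a ≤fin b

module _ (T : Triple) (_≤fin_ : FinRel T) where
  open Triple T

  private
    T×2^ω : Triple
    T×2^ω = ProdTriple T _≤fin_
    R× : Set
    R× = prodR T _≤fin_
    AR× : Set
    AR× = prodAR T _≤fin_
    r× : ℕ → R× → AR×
    r× = prodr T _≤fin_
    _⪯f_ : FinRel T×2^ω
    _⪯f_ = _⪯fin_ T _≤fin_
    _≤×_ : R× → R× → Set
    _≤×_ = _⪯_ T _≤fin_

  approx-proj₁ : ∀ {a p} → IsApprox T×2^ω (a , p) → IsApprox T a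
  approx-proj₁ (n , (A , _) , e) = n , A , cong proj₁ e

  level-unique : A1 T → ∀ {A B n m} → r n A ≡ r m B → n ≡ m
  level-unique (_ , _ , coherent) e = proj₁ (coherent _ _ _ _ e)

  -- By A1, r m D ≡ c forces m to be the level k of (c , t), so t = restrict v m.
  r×-rebase : A1 T → ∀ {C D k m v c t} → r m D ≡ c → r× k (C , v) ≡ (c , t) →
              r× m (D , v) ≡ (c , t)
  r×-rebase a1 {v = v} rD≡c refl = cong₂ _,_ rD≡c (cong (restrict v) (level-unique a1 rD≡c))

  Closed-× : Closed T → Closed T×2^ω
  Closed-× closed x prefixes = (A , u) , λ k → cong₂ _,_ (rA≡x k) (restrict-u k)
    where
    prefixes₁ : (n : ℕ) → ∃[ A ] ((k : ℕ) → k < n → r k A ≡ proj₁ (x k))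
    prefixes₁ n with (A , _) , agree ← prefixes n = A , λ k k<n → cong proj₁ (agree k k<n)
    A : R
    A = proj₁ (closed (proj₁ ∘ x) prefixes₁)
    rA≡x : (k : ℕ) → r k A ≡ proj₁ (x k)
    rA≡x = proj₂ (closed (proj₁ ∘ x) prefixes₁)
    -- The default bit is never used: x (suc n) has n + 1 bits.
    u : ℕ → Bool
    u n = fromMaybe false (last (proj₂ (x (suc n))))
    restrict-u : (k : ℕ) → restrict u k ≡ proj₂ (x k)
    restrict-u k with (_ , w) , agree ← prefixes (suc k) =
      trans (applyUpTo-cong k u≗w) (cong proj₂ (agree k ≤-refl))
      where
      u≗w : ∀ i → i < k → u i ≡ w i
      u≗w i i<k = begin
        u i
          ≡⟨ cong (fromMaybe false ∘ last ∘ proj₂) (agree (suc i) (s<s i<k)) ⟨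
        fromMaybe false (last (restrict w (suc i)))
          ≡⟨ cong (fromMaybe false) (last-applyUpTo w i) ⟩
        w i
          ∎

  ≈×-isEquivalence : IsEquivalence _≈_ → IsEquivalence (Triple._≈_ T×2^ω)
  ≈×-isEquivalence ≈-equivalence =
    ×-isEquivalence ≈-equivalence (Setoid.isEquivalence (ℕ →-setoid Bool))

  ≤×-quasiOrder : ∀ {Small : SizeNotion} → A2With T _≤fin_ Small → QuasiOrderR T×2^ω
  ≤×-quasiOrder (≤fin-refl , ≤fin-trans , _) = reflexive , transitive
    where
    reflexive : (X : R×) → X ≤× X
    reflexive (A , _) n = n , ≤fin-refl (r n A) (n , A , refl)
    transitive : (X Y Z : R×) → X ≤× Y → Y ≤× Z → X ≤× Z
    transitive (A , _) (B , _) (C , _) A≤B B≤C n with m , p ← A≤B n with k , q ← B≤C m =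
      k , ≤fin-trans _ _ _ (n , A , refl) (m , B , refl) (k , C , refl) p q

  A1-× : A1 T → A1 T×2^ω
  A1-× (r₀-constant , r-determines , r-coherent) =
      (λ (A , _) (B , _) → cong (_, []) (r₀-constant A B))
    , (λ (A , u) (B , v) r≡r → r-determines A B (cong proj₁ ∘ r≡r)
                             , λ n → applyUpTo-agree {f = u} {v} ≤-refl (cong proj₂ (r≡r (suc n))))
    , r×-coherent
    where
    r×-coherent : (X Y : R×) (n m : ℕ) → r× n X ≡ r× m Y →
                  (n ≡ m) × ((k : ℕ) → k < n → r× k X ≡ r× k Y)
    r×-coherent (A , u) (B , v) n m e with refl , agree ← r-coherent A B n m (cong proj₁ e) =
      refl , λ k k<n → cong₂ _,_ (agree k k<n) (applyUpTo-prefix (<⇒≤ k<n) (cong proj₂ e))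

  A2-× : ∀ {Small : SizeNotion} → A1 T →
         (∀ b q → Small (Below T _≤fin_ b) → Small (Below T×2^ω _⪯f_ (b , q))) →
         A2With T _≤fin_ Small → A2With T×2^ω _⪯f_ Small
  A2-× a1 lift (≤fin-refl , ≤fin-trans , small , _ , ⊑-≤fin) =
      (λ (a , _) ap → ≤fin-refl a (approx-proj₁ ap))
    , (λ (a , _) (b , _) (c , _) ap bp cp →
         ≤fin-trans a b c (approx-proj₁ ap) (approx-proj₁ bp) (approx-proj₁ cp))
    , (λ (b , q) bp → lift b q (small b (approx-proj₁ bp)))
    , (λ _ _ → id , id)
    , ⊑-⪯f
    where
    ⊑-⪯f : (a b c : AR×) → IsApprox T×2^ω c → _⊑_ T×2^ω a b → b ⪯f c →
           ∃[ d ] (_⊑_ T×2^ω d c × a ⪯f d)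
    ⊑-⪯f _ _ (c , t) (k , (C , v) , rC≡c) ((A , _) , n , m , n≤m , refl , refl) b≤c
      with d , (D , n′ , m′ , n′≤m′ , refl , rD≡c) , a≤d
             ← ⊑-≤fin _ _ c (k , C , cong proj₁ rC≡c) (A , n , m , n≤m , refl , refl) b≤c =
      r× n′ (D , v) , ((D , v) , n′ , m′ , n′≤m′ , refl , r×-rebase a1 rD≡c rC≡c) , a≤d

  LastBitTrue : Pred AR× 0ℓ
  LastBitTrue (_ , p) = last p ≡ just true

  module _ {Small : SizeNotion} (a2 : A2With T _≤fin_ Small) where

    ≤⇒≤fin : ∀ {A B} → A ≤ B → (n : ℕ) → ∃[ m ] (r n A ≤fin r m B)
    ≤⇒≤fin = let _ , _ , _ , ≤⇔≤fin , _ = a2 in proj₁ (≤⇔≤fin _ _)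

    ≤fin⇒≤ : ∀ {A B} → ((n : ℕ) → ∃[ m ] (r n A ≤fin r m B)) → A ≤ B
    ≤fin⇒≤ = let _ , _ , _ , ≤⇔≤fin , _ = a2 in proj₂ (≤⇔≤fin _ _)

    A3-× : A1 T → A3 T _≤fin_ → A3 T×2^ω _⪯f_
    A3-× a1 (nonempty , refine) = nonempty× , refine×
      where
      nonempty× : (a : AR×) (B : R×) (n : ℕ) → IsApprox T×2^ω a → IsDepth T×2^ω _⪯f_ B a n →
                  (A : R×) → InNBracket T×2^ω n B A → ∃[ C ] InBracket T×2^ω a A C
      nonempty× (a , _) (B , _) n (i , (E , w) , rE≡a) depth (A , _) (A≤B , k , rA≡rB)
        with C , C≤A , j , rC≡a
               ← nonempty a B n (i , E , cong proj₁ rE≡a) depth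
                          A (≤fin⇒≤ A≤B , k , cong proj₁ rA≡rB) =
        (C , w) , ≤⇒≤fin C≤A , j , r×-rebase a1 rC≡a rE≡a
      refine× : (a : AR×) (A B : R×) (n : ℕ) → A ≤× B → ∃[ C ] InBracket T×2^ω a A C →
                IsDepth T×2^ω _⪯f_ B a n →
                ∃[ A′ ] (InNBracket T×2^ω n B A′
                         × ∃[ C ] InBracket T×2^ω a A′ C
                         × ((C : R×) → InBracket T×2^ω a A′ C → InBracket T×2^ω a A C))
      refine× (a , _) (A , _) (B , v) n A≤B ((C₀ , w) , C₀≤A , j , rC₀≡a) depth
        with A′ , (A′≤B , k , rA′≡rB) , C , (C≤A′ , i , rC≡a) , ⊆[a,A]
               ← refine a A B n (≤fin⇒≤ A≤B) (C₀ , ≤fin⇒≤ C₀≤A , j , cong proj₁ rC₀≡a) depth =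
          (A′ , v)
        , (≤⇒≤fin A′≤B , k , r×-rebase a1 rA′≡rB refl)
        , (C , w) , (≤⇒≤fin C≤A′ , i , r×-rebase a1 rC≡a rC₀≡a)
        , λ (D , _) (D≤A′ , l , rD≡a) →
            ≤⇒≤fin (proj₁ (⊆[a,A] D (≤fin⇒≤ D≤A′ , l , cong proj₁ rD≡a))) , l , rD≡a

    LastBitTrue-biasymptotic : A1 T → A3 T _≤fin_ → Biasymptotic T×2^ω _⪯f_ LastBitTrue
    LastBitTrue-biasymptotic a1 (nonempty , _)
                             (A , _) _ d l ((E , w) , refl) depth (B , v) (B≤A , k , rB≡rA)
      with C , C≤B , j , rC≡rE
             ← nonempty (r l E) A d (l , E , refl) depth B (≤fin⇒≤ B≤A , k , cong proj₁ rB≡rA)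
      with refl ← level-unique a1 rC≡rE =
        (extension true , extension-∈ true , last-extension true)
      , (extension false , extension-∈ false ,
         λ e → case trans (sym (last-extension false)) e of λ ())
      where
      extension : Bool → AR×
      extension b = r× (suc l) (C , prefixThen w l b)
      extension-∈ : ∀ b → InRN T×2^ω _⪯f_ (suc l) (r× l (E , w)) (B , v) (extension b)
      extension-∈ b =
          ((C , prefixThen w l b) , refl)
        , ((C , prefixThen w l b) , l , suc l , n≤1+n l
          , cong₂ _,_ rC≡rE (applyUpTo-cong l (λ _ → prefixThen-< w b)) , refl)
        , ≤⇒≤fin C≤B (suc l)
      last-extension : ∀ b → last (proj₂ (extension b)) ≡ just b
      last-extension b =
        trans (last-applyUpTo (prefixThen w l b) l) (cong just (prefixThen-self w l b))

  approx-bits-finite : A1 T → ∀ {a} → IsApprox T a → Finite (λ p → IsApprox T×2^ω (a , p))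
  approx-bits-finite a1 (n , A , rA≡a) = bitstrings n , λ { _ (m , (B , u) , refl) →
    subst (λ k → restrict u m ∈ bitstrings k) (sym (level-unique a1 rA≡a))
          (restrict-∈-bitstrings u m) }

  Countable-Below× : ∀ b q → Countable (Below T _≤fin_ b) → Countable (Below T×2^ω _⪯f_ (b , q))
  Countable-Below× b q countable =
    Countable-⊆ (λ (ap , a≤b) → approx-proj₁ ap , a≤b)
                (Countable-×ʳ decode decode-surjective countable)

  Finite-Below× : ExcludedMiddle 0ℓ → A1 T →
                  ∀ b q → Finite (Below T _≤fin_ b) → Finite (Below T×2^ω _⪯f_ (b , q))
  Finite-Below× em a1 b q finite =
    Finite-⊆ (λ (ap , a≤b) → (approx-proj₁ ap , a≤b) , ap)
             (Finite-Σ em finite (λ _ (ap , _) → approx-bits-finite a1 ap))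

  product-space : (Small : SizeNotion) →
    (A1 T → ∀ b q → Small (Below T _≤fin_ b) → Small (Below T×2^ω _⪯f_ (b , q))) →
    IsSpaceWith T _≤fin_ Small →
    IsSpaceWith T×2^ω _⪯f_ Small × ∃[ O ] Biasymptotic T×2^ω _⪯f_ O
  -- ≤× is generated by ≤fin alone.
  product-space Small lift (closed , ≈-equivalence , _ , a1 , a2 , a3) =
      ( Closed-× closed
      , ≈×-isEquivalence ≈-equivalence
      , ≤×-quasiOrder {Small} a2
      , A1-× a1
      , A2-× {Small} a1 (lift a1) a2
      , A3-× {Small} a2 a1 a3)
    , LastBitTrue , LastBitTrue-biasymptotic {Small} a2 a1 a3

lemma4p1 : ExcludedMiddle 0ℓ →
    ((T : Triple) (_≤fin_ : FinRel T) → IsSpaceWith T _≤fin_ Countable →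
    IsSpaceWith (ProdTriple T _≤fin_) (_⪯fin_ T _≤fin_) Countable
    × ∃[ O ] Biasymptotic (ProdTriple T _≤fin_) (_⪯fin_ T _≤fin_) O)
    × ((T : Triple) (_≤fin_ : FinRel T) → IsSpaceWith T _≤fin_ Finite →
    IsSpaceWith (ProdTriple T _≤fin_) (_⪯fin_ T _≤fin_) Finite
    × ∃[ O ] Biasymptotic (ProdTriple T _≤fin_) (_⪯fin_ T _≤fin_) O)
lemma4p1 em =
    (λ T _≤fin_ → product-space T _≤fin_ Countable (λ _ → Countable-Below× T _≤fin_))
  , (λ T _≤fin_ → product-space T _≤fin_ Finite (Finite-Below× T _≤fin_ em))
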